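{- Let $G$ be a connected graph with $\frac{1}{2}(\mathsf{MM}(G) + \mathsf{IS}(G)) = \mathsf{IM}(G)$. Then one of the following holds: (1) $G$ is a single edge (two vertices joined by an edge); (2) $G$ is a triangle star; (3) $G$ is obtained from a connected bipartite graph $G'$ with bipartition $V(G') = U \cup W$ by adding exactly one pendant vertex to each vertex of $U$ and adding at least one pendant triangle to each vertex of $W$; in this case $\mathsf{MM}(G) = \mathsf{IS}(G) = \mathsf{IM}(G) = \frac{1}{2}(|V(G)| - |W|)$.
   Context: All graphs are finite, simple and undirected. $\mathsf{MM}(G)$, $\mathsf{IS}(G)$, $\mathsf{IM}(G)$ denote the maximum size of a matching, of an independent set, and of an induced matching of $G$, respectively; a matching $M$ is induced if no edge of $G$ joins endpoints of two distinct edges of $M$. Adding a pendant vertex to $u$ means adding a new vertex adjacent only to $u$. Adding a pendant triangle to a vertex $s$ means adding two new vertices $x,y$ and the edges $xy, xs, ys$. A triangle star is a graph obtained from a triangle by adding any number of pendant triangles to one of its vertices. -}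

module Defs where

open import Data.Nat using (ℕ; zero; suc; _+_; _*_; _∸_; _≤_)
open import Data.Fin using (Fin; toℕ)
open import Data.Fin.Subset using (Subset; _∈_; ∁; ∣_∣)
open import Data.Bool using (Bool; true; false)
open import Data.List using (List; length)
open import Data.List.Relation.Unary.All using (All)
open import Data.List.Relation.Unary.AllPairs using (AllPairs)
open import Data.Product using (Σ; ∃; _×_; _,_; proj₁; proj₂)
open import Data.Sum using (_⊎_)
open import Relation.Nullary using (¬_)
open import Relation.Binary using (Decidable)
open import Relation.Binary.PropositionalEquality using (_≡_; _≢_)
open import Function.Bundles using (_↔_; _⇔_; Inverse)

record Graph (n : ℕ) : Set₁ where
  field
    Adj    : Fin n → Fin n → Set
    sym    : ∀ {x y} → Adj x y → Adj y x
    irrefl : ∀ {x} → ¬ Adj x x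
    dec    : Decidable Adj
open Graph public

module _ {n : ℕ} (G : Graph n) where

  data Reachable : Fin n → Fin n → Set where
    here : ∀ {x} → Reachable x x
    step : ∀ {x y z} → Adj G x y → Reachable y z → Reachable x z

  -- connected graphs are nonempty
  Connected : Set
  Connected = Fin n × (∀ x y → Reachable x y)

  Disjoint : Fin n × Fin n → Fin n × Fin n → Set
  Disjoint (a , b) (c , d) = a ≢ c × a ≢ d × b ≢ c × b ≢ d

  NoEdgeBetween : Fin n × Fin n → Fin n × Fin n → Set
  NoEdgeBetween (a , b) (c , d) =
    ¬ Adj G a c × ¬ Adj G a d × ¬ Adj G b c × ¬ Adj G b d

  IsMatching : List (Fin n × Fin n) → Set
  IsMatching M = All (λ e → Adj G (proj₁ e) (proj₂ e)) M × AllPairs Disjoint M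

  IsInducedMatching : List (Fin n × Fin n) → Set
  IsInducedMatching M =
    All (λ e → Adj G (proj₁ e) (proj₂ e)) M
      × AllPairs (λ e f → Disjoint e f × NoEdgeBetween e f) M

  IsIndependentSet : List (Fin n) → Set
  IsIndependentSet S = AllPairs (λ x y → x ≢ y × ¬ Adj G x y) S

  MM≡ : ℕ → Set
  MM≡ k = (Σ (List (Fin n × Fin n)) λ M → IsMatching M × length M ≡ k)
        × (∀ M → IsMatching M → length M ≤ k)

  IS≡ : ℕ → Set
  IS≡ k = (Σ (List (Fin n)) λ S → IsIndependentSet S × length S ≡ k)
        × (∀ S → IsIndependentSet S → length S ≤ k)

  IM≡ : ℕ → Set
  IM≡ k = (Σ (List (Fin n × Fin n)) λ M → IsInducedMatching M × length M ≡ k)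
        × (∀ M → IsInducedMatching M → length M ≤ k)

  IsoTo : (V : Set) → (V → V → Set) → Set
  IsoTo V R = Σ (Fin n ↔ V) λ f →
    ∀ x y → Adj G x y ⇔ R (Inverse.to f x) (Inverse.to f y)

SymClo : {V : Set} → (V → V → Set) → V → V → Set
SymClo E x y = E x y ⊎ E y x

data K2Edge : Bool → Bool → Set where
  e : K2Edge false true

K2Adj : Bool → Bool → Set
K2Adj = SymClo K2Edge

-- (2) triangle star: triangle a b c plus t pendant triangles at a;
-- the k-th pendant triangle has new vertices p k false, p k true
data TSV (t : ℕ) : Set where
  a b c : TSV t
  p     : Fin t → Bool → TSV t

data TSEdge (t : ℕ) : TSV t → TSV t → Set where
  ab  : TSEdge t a b
  ac  : TSEdge t a c
  bc  : TSEdge t b c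
  ap  : ∀ k β → TSEdge t a (p k β)
  pp  : ∀ k → TSEdge t (p k false) (p k true)

TSAdj : (t : ℕ) → TSV t → TSV t → Set
TSAdj t = SymClo (TSEdge t)

-- (3) from a bipartite graph G' on Fin m with bipartition U ∪ W
-- (W a subset, U = ∁ W): add one pendant vertex to each u ∈ U and
-- t w ≥ 1 pendant triangles to each w ∈ W.

IsBipartition : {m : ℕ} → Graph m → Subset m → Set
IsBipartition {m} G' W = ∀ i j → Adj G' i j →
  (i ∈ W × j ∈ ∁ W) ⊎ (i ∈ ∁ W × j ∈ W)

module _ {m : ℕ} (G' : Graph m) (W : Subset m) (t : Fin m → ℕ) where

  data CV : Set where
    base : Fin m → CV
    pend : (u : Fin m) → u ∈ ∁ W → CV
    tri  : (w : Fin m) → w ∈ W → Fin (t w) → Bool → CV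

  data CEdge : CV → CV → Set where
    bb : ∀ {i j} → Adj G' i j → CEdge (base i) (base j)
    bp : ∀ u h → CEdge (base u) (pend u h)
    bt : ∀ w h k β → CEdge (base w) (tri w h k β)
    tt : ∀ w h k → CEdge (tri w h k false) (tri w h k true)

  CAdj : CV → CV → Set
  CAdj = SymClo CEdge

-- Let M be a maximum induced matching, of size k.  M is a matching and its first endpoints
-- are independent, so mm ≥ k and is ≥ k, and mm + is = 2k forces mm = is = k.  Then the set
-- W of vertices not covered by M is independent (an edge inside W would extend M), every
-- w ∈ W is adjacent to both ends of some edge of M (otherwise w together with one endpoint
-- per edge not adjacent to w is an independent set of size k + 1), and no edge ab of M has
-- neighbours w ≠ w' in W with w ~ a and w' ~ b (otherwise trading ab for wa and bw' gives a
-- matching of size k + 1).  So each edge of M either spans a triangle with a unique apex in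
-- W, or has one end u all of whose other neighbours lie in W and one pendant end.  Since M is
-- induced there are no other edges, and G is the graph of case (3) over the subgraph induced
-- by W and the ends u; the single edge and the triangle stars are the instances of case (3)
-- where that subgraph is one vertex.  Finally |V(G)| = |W| + 2k.
module Submission where

open import Defs hiding (a; b; c; p; e; ab; ac; bc; ap; pp; here; step; sym; tt)
open import Data.Nat using (ℕ; _+_; _*_; _∸_; _≤_)
open import Data.Fin using (Fin)
open import Data.Fin.Subset using (Subset; _∈_; ∣_∣)
open import Data.Bool using (Bool)
open import Data.Product using (Σ; _×_)
open import Data.Sum using (_⊎_)
open import Relation.Binary.PropositionalEquality using (_≡_)

import Defs as D
open import Data.Nat using (zero; suc; z≤n; s≤s)
open import Data.Nat.Properties
  using (≤-antisym; ≤-trans; ≤-reflexive; +-comm; +-identityʳ; +-suc; *-suc;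
         +-monoˡ-≤; +-monoʳ-≤; +-cancelʳ-≤; m+n∸m≡n; n≮n)
open import Data.Fin using (zero; suc)
open import Data.Fin.Properties using (_≟_; any?)
open import Data.Fin.Subset using (∁)
open import Data.Bool using (true; false; T; not; _∧_; _∨_; if_then_else_)
open import Data.Bool.Properties
  using (T-irrelevant; T-≡; T-not-≡; ¬-not; not-¬; not-involutive)
  renaming (_≟_ to _≟ᵇ_)
open import Data.Unit using (tt)
open import Data.Empty using (⊥; ⊥-elim)
open import Data.Product using (∃-syntax; _,_; proj₁; proj₂)
open import Data.Product.Properties using (≡-dec)
open import Data.Sum using (inj₁; inj₂)
open import Data.List using (List; []; _∷_; length; map)
open import Data.List.Properties using (length-map)
open import Data.List.Membership.Propositional using (find; lose) renaming (_∈_ to _∈ᴸ_)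
import Data.List.Relation.Unary.Any as Any
open import Data.List.Relation.Unary.All as All using (All; []; _∷_)
import Data.List.Relation.Unary.All.Properties as Allₚ
open import Data.List.Relation.Unary.AllPairs as AllPairs using (AllPairs; []; _∷_)
import Data.List.Relation.Unary.AllPairs.Properties as AllPairsₚ
open import Data.Vec using (tabulate)
open import Data.Vec.Properties using (lookup∘tabulate; lookup-map; lookup⇒[]=; []=⇒lookup)
open import Data.Vec.Properties.WithK using ([]=-irrelevant)
open import Function using (_∘_)
open import Function.Bundles using (Equivalence; mk↔ₛ′; mk⇔)
open import Relation.Nullary using (¬_; Dec; yes; no; does)
open import Relation.Nullary.Decidable using (map′; ¬?; _×-dec_; _⊎-dec_; dec-true; dec-false)
open import Relation.Binary.PropositionalEquality
  using (_≢_; refl; sym; trans; cong; cong₂; subst; subst₂; module ≡-Reasoning)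

-- enum P lists the i with T (P i) in increasing order; index is its inverse.
module Enumeration where

  incr : Bool → ℕ → ℕ
  incr true  k = suc k
  incr false k = k

  count : ∀ {n} → (Fin n → Bool) → ℕ
  count {zero}  P = 0
  count {suc n} P = incr (P zero) (count (P ∘ suc))

  mutual
    enumFrom : ∀ {n} (b : Bool) (P : Fin n → Bool) → Fin (incr b (count P)) → Fin (suc n)
    enumFrom true  P zero    = zero
    enumFrom true  P (suc i) = suc (enum P i)
    enumFrom false P i       = suc (enum P i)

    enum : ∀ {n} (P : Fin n → Bool) → Fin (count P) → Fin n
    enum {suc n} P = enumFrom (P zero) (P ∘ suc)

  enum-satisfies : ∀ {n} (P : Fin n → Bool) (i : Fin (count P)) → T (P (enum P i))
  enum-satisfies {suc n} P i = go (P zero) refl i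
    where
    go : (b : Bool) → P zero ≡ b → (i : Fin (incr b (count (P ∘ suc)))) →
         T (P (enumFrom b (P ∘ suc) i))
    go true  eq zero rewrite eq = tt
    go true  eq (suc i) = enum-satisfies (P ∘ suc) i
    go false eq i       = enum-satisfies (P ∘ suc) i

  shift : ∀ {k} (b : Bool) → Fin k → Fin (incr b k)
  shift true  j = suc j
  shift false j = j

  first : ∀ {k} (b : Bool) → T b → Fin (incr b k)
  first true _ = zero

  index : ∀ {n} (P : Fin n → Bool) (x : Fin n) → T (P x) → Fin (count P)
  index {suc n} P zero    p = first (P zero) p
  index {suc n} P (suc x) p = shift (P zero) (index (P ∘ suc) x p)

  enum-index : ∀ {n} (P : Fin n → Bool) (x : Fin n) (p : T (P x)) → enum P (index P x p) ≡ x
  enum-index {suc n} P zero p = go (P zero) p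
    where
    go : (b : Bool) (p : T b) → enumFrom b (P ∘ suc) (first b p) ≡ zero
    go true p = refl
  enum-index {suc n} P (suc x) p = go (P zero)
    where
    go : (b : Bool) → enumFrom b (P ∘ suc) (shift b (index (P ∘ suc) x p)) ≡ suc x
    go true  = cong suc (enum-index (P ∘ suc) x p)
    go false = cong suc (enum-index (P ∘ suc) x p)

  index-enum : ∀ {n} (P : Fin n → Bool) (i : Fin (count P)) (p : T (P (enum P i))) →
               index P (enum P i) p ≡ i
  index-enum {suc n} P i p = go (P zero) refl i p
    where
    go : (b : Bool) (eq : P zero ≡ b) (i : Fin (incr b (count (P ∘ suc))))
         (p : T (P (enumFrom b (P ∘ suc) i))) →
         subst (λ b → Fin (incr b (count (P ∘ suc)))) eq (index P (enumFrom b (P ∘ suc) i) p) ≡ i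
    go true  eq zero    p rewrite eq = refl
    go true  eq (suc i) p rewrite eq = cong suc (index-enum (P ∘ suc) i p)
    go false eq i       p rewrite eq = index-enum (P ∘ suc) i p

  index-cong : ∀ {n} (P : Fin n → Bool) {x y : Fin n} → x ≡ y →
               (p : T (P x)) (q : T (P y)) → index P x p ≡ index P y q
  index-cong P refl p q = cong (index P _) (T-irrelevant p q)

  index-unique : ∀ {n} (P : Fin n → Bool) (i : Fin (count P)) {x} → x ≡ enum P i →
                 (p : T (P x)) → index P x p ≡ i
  index-unique P i refl p = index-enum P i p

  satisfied⇒1≤count : ∀ {n} (P : Fin n → Bool) (x : Fin n) → T (P x) → 1 ≤ count P
  satisfied⇒1≤count P x p with count P | index P x p
  ... | suc _ | _ = s≤s z≤n

  count-cong : ∀ {n} (P Q : Fin n → Bool) → (∀ x → P x ≡ Q x) → count P ≡ count Q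
  count-cong {zero}  P Q eq = refl
  count-cong {suc n} P Q eq rewrite eq zero = cong (incr (Q zero)) (count-cong _ _ (eq ∘ suc))

  count-false : ∀ n → count {n} (λ _ → false) ≡ 0
  count-false zero    = refl
  count-false (suc n) = count-false n

  count-≟ : ∀ {n} (a : Fin n) → count (λ x → does (x ≟ a)) ≡ 1
  count-≟ {suc n} zero    = cong suc (count-false n)
  count-≟ {suc n} (suc a) = count-≟ a

  count-complement : ∀ {n} (P : Fin n → Bool) → count P + count (not ∘ P) ≡ n
  count-complement {zero} P = refl
  count-complement {suc n} P with P zero
  ... | true  = cong suc (count-complement (P ∘ suc))
  ... | false = trans (+-suc _ _) (cong suc (count-complement (P ∘ suc)))

  count-∨ : ∀ {n} (P Q : Fin n → Bool) → (∀ x → T (P x) → T (Q x) → ⊥) →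
            count (λ x → P x ∨ Q x) ≡ count P + count Q
  count-∨ {zero} P Q disjoint = refl
  count-∨ {suc n} P Q disjoint with P zero in eP | Q zero in eQ
  ... | true  | true  = ⊥-elim (disjoint zero (subst T (sym eP) tt) (subst T (sym eQ) tt))
  ... | true  | false = cong suc (count-∨ _ _ (disjoint ∘ suc))
  ... | false | true  = trans (cong suc (count-∨ _ _ (disjoint ∘ suc))) (sym (+-suc _ _))
  ... | false | false = count-∨ _ _ (disjoint ∘ suc)

  count-∘enum : ∀ {n} (P Q : Fin n → Bool) → count (Q ∘ enum P) ≡ count (λ x → P x ∧ Q x)
  count-∘enum {zero}  P Q = refl
  count-∘enum {suc n} P Q = go (P zero)
    where
    go : (b : Bool) → count (Q ∘ enumFrom b (P ∘ suc)) ≡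
                      incr (b ∧ Q zero) (count (λ x → P (suc x) ∧ Q (suc x)))
    go true  = cong (incr (Q zero)) (count-∘enum (P ∘ suc) (Q ∘ suc))
    go false = count-∘enum (P ∘ suc) (Q ∘ suc)

  ∣tabulate∣≡count : ∀ {n} (P : Fin n → Bool) → ∣ tabulate P ∣ ≡ count P
  ∣tabulate∣≡count {zero} P = refl
  ∣tabulate∣≡count {suc n} P with P zero
  ... | true  = cong suc (∣tabulate∣≡count (P ∘ suc))
  ... | false = ∣tabulate∣≡count (P ∘ suc)

open Enumeration

AllPairs-either : ∀ {A : Set} {R : A → A → Set} {xs : List A} → AllPairs R xs →
  ∀ {x y} → x ∈ᴸ xs → y ∈ᴸ xs → x ≢ y → R x y ⊎ R y x
AllPairs-either (rx ∷ rxs) (Any.here refl)  (Any.here refl)  x≢y = ⊥-elim (x≢y refl)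
AllPairs-either (rx ∷ rxs) (Any.here refl)  (Any.there y∈)   x≢y = inj₁ (All.lookup rx y∈)
AllPairs-either (rx ∷ rxs) (Any.there x∈)   (Any.here refl)  x≢y = inj₂ (All.lookup rx x∈)
AllPairs-either (rx ∷ rxs) (Any.there x∈)   (Any.there y∈)   x≢y = AllPairs-either rxs x∈ y∈ x≢y

AllPairs-map∈ : ∀ {A : Set} {R S : A → A → Set} {xs : List A} →
  (∀ {x y} → x ∈ᴸ xs → y ∈ᴸ xs → R x y → S x y) → AllPairs R xs → AllPairs S xs
AllPairs-map∈ f [] = []
AllPairs-map∈ f (rx ∷ rxs) =
  All.tabulate (λ y∈ → f (Any.here refl) (Any.there y∈) (All.lookup rx y∈)) ∷
  AllPairs-map∈ (λ x∈ y∈ → f (Any.there x∈) (Any.there y∈)) rxs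

∃∈? : ∀ {A : Set} {P : A → Set} → (∀ x → Dec (P x)) → (xs : List A) →
      Dec (∃[ x ] x ∈ᴸ xs × P x)
∃∈? P? xs = map′ find (λ { (x , x∈ , px) → lose x∈ px }) (Any.any? P? xs)

witness : ∀ {A : Set} (a? : Dec A) → T (does a?) → A
witness (yes a) _ = a

_∈ₑ_ : ∀ {n} → Fin n → Fin n × Fin n → Set
x ∈ₑ e = x ≡ proj₁ e ⊎ x ≡ proj₂ e

_∈ₑ?_ : ∀ {n} (x : Fin n) (e : Fin n × Fin n) → Dec (x ∈ₑ e)
x ∈ₑ? e = x ≟ proj₁ e ⊎-dec x ≟ proj₂ e

module _ {n : ℕ} (G : Graph n) where

  Separated : Fin n × Fin n → Fin n × Fin n → Set
  Separated e f = Disjoint G e f × NoEdgeBetween G e f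

  Separated-sym : ∀ {e f} → Separated e f → Separated f e
  Separated-sym ((d₁ , d₂ , d₃ , d₄) , (a₁ , a₂ , a₃ , a₄)) =
    ((d₁ ∘ sym) , (d₃ ∘ sym) , (d₂ ∘ sym) , (d₄ ∘ sym)) ,
    ((a₁ ∘ Graph.sym G) , (a₃ ∘ Graph.sym G) , (a₂ ∘ Graph.sym G) , (a₄ ∘ Graph.sym G))

  Disjoint⇒≢ : ∀ {e f x y} → Disjoint G e f → x ∈ₑ e → y ∈ₑ f → x ≢ y
  Disjoint⇒≢ (d , _ , _ , _) (inj₁ refl) (inj₁ refl) = d
  Disjoint⇒≢ (_ , d , _ , _) (inj₁ refl) (inj₂ refl) = d
  Disjoint⇒≢ (_ , _ , d , _) (inj₂ refl) (inj₁ refl) = d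
  Disjoint⇒≢ (_ , _ , _ , d) (inj₂ refl) (inj₂ refl) = d

  NoEdgeBetween⇒¬Adj : ∀ {e f x y} → NoEdgeBetween G e f → x ∈ₑ e → y ∈ₑ f → ¬ Adj G x y
  NoEdgeBetween⇒¬Adj (d , _ , _ , _) (inj₁ refl) (inj₁ refl) = d
  NoEdgeBetween⇒¬Adj (_ , d , _ , _) (inj₁ refl) (inj₂ refl) = d
  NoEdgeBetween⇒¬Adj (_ , _ , d , _) (inj₂ refl) (inj₁ refl) = d
  NoEdgeBetween⇒¬Adj (_ , _ , _ , d) (inj₂ refl) (inj₂ refl) = d

  Adj⇒≢ : ∀ {x y} → Adj G x y → x ≢ y
  Adj⇒≢ a refl = Graph.irrefl G a

  induced⇒matching : ∀ {M} → IsInducedMatching G M → IsMatching G M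
  induced⇒matching (adj , sep) = adj , AllPairs.map proj₁ sep

  induced⇒firsts-independent : ∀ {M} → IsInducedMatching G M → IsIndependentSet G (map proj₁ M)
  induced⇒firsts-independent (_ , sep) =
    AllPairsₚ.map⁺ (AllPairs.map (λ s → proj₁ (proj₁ s) , proj₁ (proj₂ s)) sep)

  count-covered : ∀ L → IsMatching G L → count (λ x → does (∃∈? (x ∈ₑ?_) L)) ≡ 2 * length L
  count-covered []      _ = count-false n
  count-covered (f ∷ L) (af ∷ aL , df ∷ dL) = begin
    count (λ x → (does (x ≟ proj₁ f) ∨ does (x ≟ proj₂ f)) ∨ does (∃∈? (x ∈ₑ?_) L))
      ≡⟨ count-∨ _ _ f-not-in-L ⟩
    count (λ x → does (x ≟ proj₁ f) ∨ does (x ≟ proj₂ f))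
      + count (λ x → does (∃∈? (x ∈ₑ?_) L))
      ≡⟨ cong₂ _+_ (count-∨ _ _ ends-distinct) (count-covered L (aL , dL)) ⟩
    (count (λ x → does (x ≟ proj₁ f)) + count (λ x → does (x ≟ proj₂ f))) + 2 * length L
      ≡⟨ cong (_+ 2 * length L) (cong₂ _+_ (count-≟ (proj₁ f)) (count-≟ (proj₂ f))) ⟩
    2 + 2 * length L
      ≡⟨ sym (*-suc 2 (length L)) ⟩
    2 * length (f ∷ L) ∎
    where
    open ≡-Reasoning
    ends-distinct : ∀ x → T (does (x ≟ proj₁ f)) → T (does (x ≟ proj₂ f)) → ⊥
    ends-distinct x p q = Adj⇒≢ af (trans (sym (witness (x ≟ proj₁ f) p)) (witness (x ≟ proj₂ f) q))
    f-not-in-L : ∀ x → T (does (x ∈ₑ? f)) → T (does (∃∈? (x ∈ₑ?_) L)) → ⊥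
    f-not-in-L x p q with witness (∃∈? (x ∈ₑ?_) L) q
    ... | g , g∈ , x∈g = Disjoint⇒≢ (All.lookup df g∈) (witness (x ∈ₑ? f) p) x∈g refl

module Structure {n : ℕ} (G : Graph n) (M : List (Fin n × Fin n)) (k : ℕ)
  (M-induced : IsInducedMatching G M) (|M|≡k : length M ≡ k)
  (matching-bound : ∀ N → IsMatching G N → length N ≤ k)
  (independent-bound : ∀ S → IsIndependentSet G S → length S ≤ k) where

  Edge : Set
  Edge = Fin n × Fin n

  _≟ₑ_ : (e f : Edge) → Dec (e ≡ f)
  _≟ₑ_ = ≡-dec _≟_ _≟_

  infix 4 _~_
  _~_ : Fin n → Fin n → Set
  _~_ = Adj G

  ~-sym : ∀ {x y} → x ~ y → y ~ x
  ~-sym = Graph.sym G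

  M-adj : ∀ {e} → e ∈ᴸ M → proj₁ e ~ proj₂ e
  M-adj = All.lookup (proj₁ M-induced)

  M-separated : ∀ {e f} → e ∈ᴸ M → f ∈ᴸ M → e ≢ f → Separated G e f
  M-separated e∈ f∈ e≢f with AllPairs-either (proj₂ M-induced) e∈ f∈ e≢f
  ... | inj₁ s = s
  ... | inj₂ s = Separated-sym G s

  M-edge-unique : ∀ {e f x} → e ∈ᴸ M → f ∈ᴸ M → x ∈ₑ e → x ∈ₑ f → e ≡ f
  M-edge-unique {e} {f} e∈ f∈ x∈e x∈f with e ≟ₑ f
  ... | yes e≡f = e≡f
  ... | no  e≢f = ⊥-elim (Disjoint⇒≢ G (proj₁ (M-separated e∈ f∈ e≢f)) x∈e x∈f refl)

  M-disjoint : AllPairs (Disjoint G) M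
  M-disjoint = proj₂ (induced⇒matching G M-induced)

  exceeds-bound : ∀ {A : Set} (xs : List A) → length xs ≡ suc (length M) → ¬ (length xs ≤ k)
  exceeds-bound xs eq le = n≮n k (subst (_≤ k) (trans eq (cong suc |M|≡k)) le)

  Covered : Fin n → Set
  Covered x = ∃[ e ] e ∈ᴸ M × x ∈ₑ e

  Uncovered : Fin n → Set
  Uncovered x = ¬ Covered x

  covered? : ∀ x → Dec (Covered x)
  covered? x = ∃∈? (x ∈ₑ?_) M

  uncovered≢endpoint : ∀ {r e x} → Uncovered r → e ∈ᴸ M → x ∈ₑ e → r ≢ x
  uncovered≢endpoint r-unc e∈ x∈e refl = r-unc (_ , e∈ , x∈e)

  uncovered-independent : ∀ {r s} → Uncovered r → Uncovered s → ¬ r ~ s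
  uncovered-independent {r} {s} r-unc s-unc r~s =
    exceeds-bound N refl (matching-bound N (r~s ∷ proj₁ M-induced , disjoint ∷ M-disjoint))
    where
    N = (r , s) ∷ M
    disjoint : All (Disjoint G (r , s)) M
    disjoint = All.tabulate λ e∈ →
      uncovered≢endpoint r-unc e∈ (inj₁ refl) , uncovered≢endpoint r-unc e∈ (inj₂ refl) ,
      uncovered≢endpoint s-unc e∈ (inj₁ refl) , uncovered≢endpoint s-unc e∈ (inj₂ refl)

  -- Otherwise trading e = ab for ra and bs gives a matching with k + 1 edges.
  uncovered-neighbours-coincide : ∀ {e r s} → e ∈ᴸ M → Uncovered r → Uncovered s →
    r ~ proj₁ e → s ~ proj₂ e → r ≡ s
  uncovered-neighbours-coincide {e} {r} {s} e∈ r-unc s-unc r~a s~b with r ≟ s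
  ... | yes r≡s = r≡s
  ... | no  r≢s = ⊥-elim (exceeds-bound N (cong suc (length-map trade M))
                            (matching-bound N (adjacent , disjoint)))
    where
    trade : Edge → Edge
    trade f = if does (f ≟ₑ e) then (proj₂ e , s) else f
    N = (r , proj₁ e) ∷ map trade M
    trade-adj : ∀ {f} → proj₁ f ~ proj₂ f → proj₁ (trade f) ~ proj₂ (trade f)
    trade-adj {f} f-adj with f ≟ₑ e
    ... | yes refl = ~-sym s~b
    ... | no  _    = f-adj
    adjacent = r~a ∷ Allₚ.map⁺ (All.map trade-adj (proj₁ M-induced))
    first-disjoint : ∀ {f} → f ∈ᴸ M → Disjoint G (r , proj₁ e) (trade f)
    first-disjoint {f} f∈ with f ≟ₑ e
    ... | yes refl = uncovered≢endpoint r-unc e∈ (inj₂ refl) , r≢s , Adj⇒≢ G (M-adj e∈) ,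
                     (λ a≡s → uncovered≢endpoint s-unc e∈ (inj₁ refl) (sym a≡s))
    ... | no f≢e with M-separated f∈ e∈ f≢e
    ...   | (d₁ , _ , d₃ , _) , _ = uncovered≢endpoint r-unc f∈ (inj₁ refl) ,
                                   uncovered≢endpoint r-unc f∈ (inj₂ refl) , d₁ ∘ sym , d₃ ∘ sym
    trade-disjoint : ∀ {f g} → f ∈ᴸ M → g ∈ᴸ M → Disjoint G f g → Disjoint G (trade f) (trade g)
    trade-disjoint {f} {g} f∈ g∈ d with f ≟ₑ e | g ≟ₑ e | d
    ... | yes refl | yes refl | d₁ , _ = ⊥-elim (d₁ refl)
    ... | yes refl | no _ | _ , _ , d₃ , d₄ =
      d₃ , d₄ , uncovered≢endpoint s-unc g∈ (inj₁ refl) , uncovered≢endpoint s-unc g∈ (inj₂ refl)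
    ... | no _ | yes refl | _ , d₂ , _ , d₄ =
      d₂ , (λ f₁≡s → uncovered≢endpoint s-unc f∈ (inj₁ refl) (sym f₁≡s)) ,
      d₄ , (λ f₂≡s → uncovered≢endpoint s-unc f∈ (inj₂ refl) (sym f₂≡s))
    ... | no _ | no _ | _ = d
    disjoint : AllPairs (Disjoint G) N
    disjoint = Allₚ.map⁺ (All.tabulate first-disjoint) ∷
               AllPairsₚ.map⁺ (AllPairs-map∈ trade-disjoint M-disjoint)

  Apex : Fin n → Edge → Set
  Apex r f = r ~ proj₁ f × r ~ proj₂ f

  apex? : ∀ r f → Dec (Apex r f)
  apex? r f = Graph.dec G r (proj₁ f) ×-dec Graph.dec G r (proj₂ f)

  -- Otherwise r together with, on each edge of M, an endpoint not adjacent to r is an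
  -- independent set with k + 1 elements.
  uncovered-apex : ∀ {r} → Uncovered r → ∃[ f ] f ∈ᴸ M × Apex r f
  uncovered-apex {r} r-unc with ∃∈? (apex? r) M
  ... | yes apex = apex
  ... | no ¬apex = ⊥-elim (exceeds-bound S (cong suc (length-map pick M))
                            (independent-bound S independent))
    where
    pick : Edge → Fin n
    pick f = if does (Graph.dec G r (proj₁ f)) then proj₂ f else proj₁ f
    pick-∈ₑ : ∀ f → pick f ∈ₑ f
    pick-∈ₑ f with Graph.dec G r (proj₁ f)
    ... | yes _ = inj₂ refl
    ... | no  _ = inj₁ refl
    S = r ∷ map pick M
    r-independent-of-pick : ∀ {f} → f ∈ᴸ M → r ≢ pick f × ¬ r ~ pick f
    r-independent-of-pick {f} f∈ with Graph.dec G r (proj₁ f)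
    ... | yes r~a = uncovered≢endpoint r-unc f∈ (inj₂ refl) , (λ r~b → ¬apex (f , f∈ , r~a , r~b))
    ... | no  r≁a = uncovered≢endpoint r-unc f∈ (inj₁ refl) , r≁a
    picks-independent : ∀ {f g} → Separated G f g → pick f ≢ pick g × ¬ pick f ~ pick g
    picks-independent {f} {g} (d , ne) =
      Disjoint⇒≢ G d (pick-∈ₑ f) (pick-∈ₑ g) ,
      NoEdgeBetween⇒¬Adj G ne (pick-∈ₑ f) (pick-∈ₑ g)
    independent : IsIndependentSet G S
    independent = Allₚ.map⁺ (All.tabulate r-independent-of-pick) ∷
                  AllPairsₚ.map⁺ (AllPairs.map picks-independent (proj₂ M-induced))

  other : Fin n → Edge → Fin n
  other x f with x ≟ proj₁ f
  ... | yes _ = proj₂ f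
  ... | no  _ = proj₁ f

  other-∈ₑ : ∀ x f → other x f ∈ₑ f
  other-∈ₑ x f with x ≟ proj₁ f
  ... | yes _ = inj₂ refl
  ... | no  _ = inj₁ refl

  neighbour-of-covered : ∀ {x y f} → f ∈ᴸ M → x ∈ₑ f → x ~ y → y ≡ other x f ⊎ Uncovered y
  neighbour-of-covered {x} {y} {f} f∈ x∈f x~y with covered? y
  ... | no  y-unc = inj₂ y-unc
  ... | yes (g , g∈ , y∈g) with f ≟ₑ g
  ...   | no  f≢g  = ⊥-elim (NoEdgeBetween⇒¬Adj G (proj₂ (M-separated f∈ g∈ f≢g)) x∈f y∈g x~y)
  ...   | yes refl = inj₁ (same-edge x∈f y∈g)
    where
    same-edge : x ∈ₑ f → y ∈ₑ f → y ≡ other x f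
    same-edge x∈f y∈f with x ≟ proj₁ f
    same-edge x∈f           (inj₁ refl) | yes refl = ⊥-elim (Adj⇒≢ G x~y refl)
    same-edge x∈f           (inj₂ y≡b)  | yes _    = y≡b
    same-edge (inj₁ x≡a)    y∈f         | no  x≢a  = ⊥-elim (x≢a x≡a)
    same-edge (inj₂ refl)   (inj₁ y≡a)  | no  _    = y≡a
    same-edge (inj₂ refl)   (inj₂ refl) | no  _    = ⊥-elim (Adj⇒≢ G x~y refl)

  Triangle : Edge → Set
  Triangle f = ∃[ w ] Uncovered w × Apex w f

  triangle? : ∀ f → Dec (Triangle f)
  triangle? f = any? (λ w → ¬? (covered? w) ×-dec apex? w f)

  HasUncoveredNeighbour : Fin n → Set
  HasUncoveredNeighbour x = ∃[ w ] Uncovered w × x ~ w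

  hasUncoveredNeighbour? : ∀ x → Dec (HasUncoveredNeighbour x)
  hasUncoveredNeighbour? x = any? (λ w → ¬? (covered? w) ×-dec Graph.dec G x w)

  -- The endpoints of an edge are its sides false (first) and true (second); in an edge of
  -- kind pendant β the endpoint on side β is the pendant vertex.
  data EdgeKind : Set where
    triangle : Fin n → EdgeKind
    pendant  : Bool → EdgeKind

  kind : Edge → EdgeKind
  kind f with triangle? f
  ... | yes (w , _) = triangle w
  ... | no  _       = pendant (does (hasUncoveredNeighbour? (proj₁ f)))

  side : Fin n → Edge → Bool
  side x f with x ≟ proj₁ f
  ... | yes _ = false
  ... | no  _ = true

  endpoint : Bool → Edge → Fin n
  endpoint false f = proj₁ f
  endpoint true  f = proj₂ f

  -- The place of a vertex in the graph of case (3): a vertex of W or of U, the pendant vertex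
  -- at u, or the corner on side s of the edge f of a triangle at w.
  data Role : Set where
    w-vertex    : Fin n → Role
    u-vertex    : Fin n → Role
    pendant-of  : Fin n → Role
    triangle-at : Fin n → Edge → Bool → Role

  roleIn : Fin n → Edge → EdgeKind → Role
  roleIn x f (triangle w) = triangle-at w f (side x f)
  roleIn x f (pendant β)  = if does (side x f ≟ᵇ β) then pendant-of (other x f) else u-vertex x

  roleOnEdge : Fin n → Edge → Role
  roleOnEdge x f = roleIn x f (kind f)

  role : Fin n → Role
  role x with covered? x
  ... | no  _           = w-vertex x
  ... | yes (f , _ , _) = roleOnEdge x f

  role-uncovered : ∀ {x} → Uncovered x → role x ≡ w-vertex x
  role-uncovered {x} x-unc with covered? x
  ... | no  _   = refl
  ... | yes cov = ⊥-elim (x-unc cov)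

  role-covered : ∀ {x f} → f ∈ᴸ M → x ∈ₑ f → role x ≡ roleOnEdge x f
  role-covered {x} {f} f∈ x∈f with covered? x
  ... | no  x-unc        = ⊥-elim (x-unc (f , f∈ , x∈f))
  ... | yes (g , g∈ , x∈g) = cong (roleOnEdge x) (M-edge-unique g∈ f∈ x∈g x∈f)

  role-cases : ∀ x → (Uncovered x × role x ≡ w-vertex x)
                   ⊎ (∃[ f ] f ∈ᴸ M × x ∈ₑ f × role x ≡ roleOnEdge x f)
  role-cases x with covered? x
  ... | no  x-unc          = inj₁ (x-unc , refl)
  ... | yes (f , f∈ , x∈f) = inj₂ (f , f∈ , x∈f , refl)

  endpoint-side : ∀ {x f} → x ∈ₑ f → endpoint (side x f) f ≡ x
  endpoint-side {x} {f} x∈f with x ≟ proj₁ f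
  endpoint-side         x∈f        | yes x≡a = sym x≡a
  endpoint-side         (inj₁ x≡a) | no  x≢a = ⊥-elim (x≢a x≡a)
  endpoint-side         (inj₂ x≡b) | no  _   = sym x≡b

  endpoint-of-side : ∀ {x f β} → x ∈ₑ f → side x f ≡ β → endpoint β f ≡ x
  endpoint-of-side x∈f refl = endpoint-side x∈f

  other≡endpoint : ∀ x f → other x f ≡ endpoint (not (side x f)) f
  other≡endpoint x f with x ≟ proj₁ f
  ... | yes _ = refl
  ... | no  _ = refl

  side-endpoint : ∀ {f} β → f ∈ᴸ M → side (endpoint β f) f ≡ β
  side-endpoint {f} false f∈ with proj₁ f ≟ proj₁ f
  ... | yes _ = refl
  ... | no  a≢a = ⊥-elim (a≢a refl)
  side-endpoint {f} true f∈ with proj₂ f ≟ proj₁ f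
  ... | yes b≡a = ⊥-elim (Adj⇒≢ G (M-adj f∈) (sym b≡a))
  ... | no  _   = refl

  side-other : ∀ {x f} → f ∈ᴸ M → side (other x f) f ≡ not (side x f)
  side-other {x} {f} f∈ rewrite other≡endpoint x f = side-endpoint (not (side x f)) f∈

  other-involutive : ∀ {x f} → f ∈ᴸ M → x ∈ₑ f → other (other x f) f ≡ x
  other-involutive {x} {f} f∈ x∈f
    rewrite other≡endpoint (other x f) f | side-other {x} f∈ | not-involutive (side x f) =
    endpoint-side x∈f

  other-adj : ∀ {x f} → f ∈ᴸ M → x ∈ₑ f → x ~ other x f
  other-adj {x} {f} f∈ x∈f with x ≟ proj₁ f
  other-adj f∈ x∈f          | yes refl = M-adj f∈
  other-adj f∈ (inj₁ x≡a)   | no  x≢a  = ⊥-elim (x≢a x≡a)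
  other-adj f∈ (inj₂ refl)  | no  _    = ~-sym (M-adj f∈)

  other-first : ∀ {f} → other (proj₁ f) f ≡ proj₂ f
  other-first {f} with proj₁ f ≟ proj₁ f
  ... | yes _   = refl
  ... | no  a≢a = ⊥-elim (a≢a refl)

  kind-triangle : ∀ {f w} → kind f ≡ triangle w → Uncovered w × Apex w f
  kind-triangle {f} eq with triangle? f
  kind-triangle refl | yes (w , w-unc , apex) = w-unc , apex

  kind-pendant : ∀ {f β} → kind f ≡ pendant β →
                 ¬ Triangle f × β ≡ does (hasUncoveredNeighbour? (proj₁ f))
  kind-pendant {f} eq with triangle? f
  kind-pendant refl | no ¬tri = ¬tri , refl

  apex-unique : ∀ {f w r x} → f ∈ᴸ M → kind f ≡ triangle w → Uncovered r →
                x ∈ₑ f → r ~ x → r ≡ w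
  apex-unique {f} f∈ eq r-unc x∈f r~x with kind-triangle eq
  apex-unique f∈ eq r-unc (inj₁ refl) r~x | w-unc , _ , w~b =
    uncovered-neighbours-coincide f∈ r-unc w-unc r~x w~b
  apex-unique f∈ eq r-unc (inj₂ refl) r~x | w-unc , w~a , _ =
    sym (uncovered-neighbours-coincide f∈ w-unc r-unc w~a r~x)

  apex⇒kind : ∀ {f w} → f ∈ᴸ M → Uncovered w → Apex w f → kind f ≡ triangle w
  apex⇒kind {f} {w} f∈ w-unc apex with triangle? f
  ... | no  ¬tri = ⊥-elim (¬tri (w , w-unc , apex))
  ... | yes (v , v-unc , v~a , _) =
    cong triangle (uncovered-neighbours-coincide f∈ v-unc w-unc v~a (proj₂ apex))

  pendant-endpoint-isolated : ∀ {f β w} → f ∈ᴸ M → kind f ≡ pendant β → Uncovered w →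
                              ¬ endpoint β f ~ w
  pendant-endpoint-isolated {f} {β} {w} f∈ eq w-unc p~w with kind-pendant eq
  ... | ¬tri , refl with hasUncoveredNeighbour? (proj₁ f)
  ...   | no  ¬has = ¬has (w , w-unc , p~w)
  ...   | yes (v , v-unc , a~v) with uncovered-neighbours-coincide f∈ v-unc w-unc (~-sym a~v) (~-sym p~w)
  ...     | refl = ¬tri (v , v-unc , ~-sym a~v , ~-sym p~w)

  roleOnEdge≢w-vertex : ∀ {x f z} → roleOnEdge x f ≢ w-vertex z
  roleOnEdge≢w-vertex {x} {f} eq with kind f
  roleOnEdge≢w-vertex {x} {f} () | triangle w
  ... | pendant β with side x f ≟ᵇ β
  roleOnEdge≢w-vertex {x} {f} () | pendant β | yes _
  roleOnEdge≢w-vertex {x} {f} () | pendant β | no  _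

  roleOnEdge-u-vertex : ∀ {x f z} → roleOnEdge x f ≡ u-vertex z →
    z ≡ x × ∃[ β ] kind f ≡ pendant β × side x f ≡ not β
  roleOnEdge-u-vertex {x} {f} eq with kind f
  roleOnEdge-u-vertex {x} {f} () | triangle w
  ... | pendant β with side x f ≟ᵇ β
  roleOnEdge-u-vertex {x} {f} ()   | pendant β | yes _
  roleOnEdge-u-vertex {x} {f} refl | pendant β | no  s≢β = refl , β , refl , ¬-not s≢β

  roleOnEdge-pendant-of : ∀ {x f u} → roleOnEdge x f ≡ pendant-of u →
    ∃[ β ] kind f ≡ pendant β × side x f ≡ β × u ≡ other x f
  roleOnEdge-pendant-of {x} {f} eq with kind f
  roleOnEdge-pendant-of {x} {f} () | triangle w
  ... | pendant β with side x f ≟ᵇ β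
  roleOnEdge-pendant-of {x} {f} refl | pendant β | yes s≡β = β , refl , s≡β , refl
  roleOnEdge-pendant-of {x} {f} ()   | pendant β | no  _

  roleOnEdge-triangle-at : ∀ {x f w h s} → roleOnEdge x f ≡ triangle-at w h s →
    kind f ≡ triangle w × h ≡ f × side x f ≡ s
  roleOnEdge-triangle-at {x} {f} eq with kind f
  roleOnEdge-triangle-at {x} {f} refl | triangle w = refl , refl , refl
  ... | pendant β with side x f ≟ᵇ β
  roleOnEdge-triangle-at {x} {f} () | pendant β | yes _
  roleOnEdge-triangle-at {x} {f} () | pendant β | no  _

  role-w-vertex : ∀ {x z} → role x ≡ w-vertex z → Uncovered x × z ≡ x
  role-w-vertex {x} eq with role-cases x
  ... | inj₁ (x-unc , r) with trans (sym eq) r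
  ...   | refl = x-unc , refl
  role-w-vertex {x} eq | inj₂ (f , _ , _ , r) = ⊥-elim (roleOnEdge≢w-vertex (trans (sym r) eq))

  role-on-edge : ∀ {x ρ} → role x ≡ ρ → (∀ z → ρ ≢ w-vertex z) →
    ∃[ f ] f ∈ᴸ M × x ∈ₑ f × roleOnEdge x f ≡ ρ
  role-on-edge {x} eq ρ≢w with role-cases x
  ... | inj₁ (_ , r)             = ⊥-elim (ρ≢w x (trans (sym eq) r))
  ... | inj₂ (f , f∈ , x∈f , r) = f , f∈ , x∈f , trans (sym r) eq

  role-u-vertex : ∀ {x z} → role x ≡ u-vertex z →
    z ≡ x × ∃[ f ] f ∈ᴸ M × x ∈ₑ f × ∃[ β ] kind f ≡ pendant β × side x f ≡ not β
  role-u-vertex eq with role-on-edge eq (λ _ ())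
  ... | f , f∈ , x∈f , r with roleOnEdge-u-vertex r
  ...   | z≡x , β , k , s = z≡x , f , f∈ , x∈f , β , k , s

  role-pendant-of : ∀ {x u} → role x ≡ pendant-of u →
    ∃[ f ] f ∈ᴸ M × x ∈ₑ f × ∃[ β ] kind f ≡ pendant β × side x f ≡ β × u ≡ other x f
  role-pendant-of eq with role-on-edge eq (λ _ ())
  ... | f , f∈ , x∈f , r with roleOnEdge-pendant-of r
  ...   | β , k , s , u≡ = f , f∈ , x∈f , β , k , s , u≡

  role-triangle-at : ∀ {x w h s} → role x ≡ triangle-at w h s →
    h ∈ᴸ M × x ∈ₑ h × kind h ≡ triangle w × side x h ≡ s
  role-triangle-at eq with role-on-edge eq (λ _ ())
  ... | f , f∈ , x∈f , r with roleOnEdge-triangle-at r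
  ...   | k , refl , s = f∈ , x∈f , k , s

  partner : Fin n → Fin n
  partner x with covered? x
  ... | no  _           = x
  ... | yes (f , _ , _) = other x f

  partner-on : ∀ {x f} → f ∈ᴸ M → x ∈ₑ f → partner x ≡ other x f
  partner-on {x} {f} f∈ x∈f with covered? x
  ... | no  x-unc          = ⊥-elim (x-unc (f , f∈ , x∈f))
  ... | yes (g , g∈ , x∈g) = cong (other x) (M-edge-unique g∈ f∈ x∈g x∈f)

  role-other : ∀ {x f} → f ∈ᴸ M → role (other x f) ≡ roleOnEdge (other x f) f
  role-other {x} {f} f∈ = role-covered f∈ (other-∈ₑ x f)

  role-other-corner : ∀ {x w h s} → role x ≡ triangle-at w h s →
                      role (other x h) ≡ triangle-at w h (not s)
  role-other-corner {x} {w} {h} {s} eq with role-triangle-at eq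
  ... | h∈ , _ , k , side≡s = begin
    role (other x h)                            ≡⟨ role-other {x} h∈ ⟩
    roleIn (other x h) h (kind h)               ≡⟨ cong (roleIn (other x h) h) k ⟩
    triangle-at w h (side (other x h) h)        ≡⟨ cong (triangle-at w h) (side-other {x} h∈) ⟩
    triangle-at w h (not (side x h))            ≡⟨ cong (triangle-at w h ∘ not) side≡s ⟩
    triangle-at w h (not s)                     ∎
    where open ≡-Reasoning

  role-other-u-vertex : ∀ {x z} → role x ≡ u-vertex z →
    ∃[ f ] f ∈ᴸ M × x ∈ₑ f × role (other x f) ≡ pendant-of x
  role-other-u-vertex {x} eq with role-u-vertex eq
  ... | _ , f , f∈ , x∈f , β , k , s = f , f∈ , x∈f , other-pendant
    where
    other-side : side (other x f) f ≡ β
    other-side = trans (side-other f∈) (trans (cong not s) (not-involutive β))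
    other-pendant : role (other x f) ≡ pendant-of x
    other-pendant rewrite role-other {x} f∈ | k | other-side | dec-true (β ≟ᵇ β) refl =
      cong pendant-of (other-involutive f∈ x∈f)

  triangle-neighbour : ∀ {x y w h s} → role x ≡ triangle-at w h s → x ~ y →
                       role y ≡ triangle-at w h (not s) ⊎ y ≡ w
  triangle-neighbour eq x~y with role-triangle-at eq
  ... | h∈ , x∈h , k , _ with neighbour-of-covered h∈ x∈h x~y
  ...   | inj₁ refl  = inj₁ (role-other-corner eq)
  ...   | inj₂ y-unc = inj₂ (apex-unique h∈ k y-unc x∈h (~-sym x~y))

  pendant-neighbour : ∀ {x y u} → role x ≡ pendant-of u → x ~ y → y ≡ u
  pendant-neighbour {x} {y} eq x~y with role-pendant-of eq
  ... | f , f∈ , x∈f , β , k , s , refl with neighbour-of-covered f∈ x∈f x~y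
  ...   | inj₁ y≡ = y≡
  ...   | inj₂ y-unc = ⊥-elim (pendant-endpoint-isolated f∈ k y-unc
                         (subst (_~ y) (sym (endpoint-of-side x∈f s)) x~y))

  u-neighbour : ∀ {x y z} → role x ≡ u-vertex z → x ~ y → role y ≡ pendant-of x ⊎ Uncovered y
  u-neighbour {x} eq x~y with role-u-vertex eq
  ... | _ , f , f∈ , x∈f , _ with neighbour-of-covered f∈ x∈f x~y
  ...   | inj₂ y-unc = inj₂ y-unc
  ...   | inj₁ refl with role-other-u-vertex eq
  ...     | g , g∈ , x∈g , r with M-edge-unique f∈ g∈ x∈f x∈g
  ...       | refl = inj₁ r

  w-neighbour : ∀ {x y z} → role x ≡ w-vertex z → x ~ y →
                role y ≡ u-vertex y ⊎ ∃[ h ] ∃[ s ] role y ≡ triangle-at x h s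
  w-neighbour {x} {y} eq x~y with role-w-vertex eq
  ... | x-unc , _ with role-cases y
  ...   | inj₁ (y-unc , _) = ⊥-elim (uncovered-independent x-unc y-unc x~y)
  ...   | inj₂ (f , f∈ , y∈f , r) with kind f in k
  ...     | triangle w rewrite apex-unique f∈ k x-unc y∈f x~y = inj₂ (f , side y f , r)
  ...     | pendant β with side y f ≟ᵇ β
  ...       | no  _   = inj₁ r
  ...       | yes s≡β = ⊥-elim (pendant-endpoint-isolated f∈ k x-unc
                          (subst (_~ x) (sym (endpoint-of-side y∈f s≡β)) (~-sym x~y)))

  isBaseRole : Role → Bool
  isBaseRole (w-vertex _) = true
  isBaseRole (u-vertex _) = true
  isBaseRole _            = false

  isWRole : Role → Bool
  isWRole (w-vertex _) = true
  isWRole _            = false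

  isFirstCornerAt : Fin n → Role → Bool
  isFirstCornerAt w (triangle-at v _ s) = does (v ≟ w) ∧ not s
  isFirstCornerAt w _                   = false

  inBase inW : Fin n → Bool
  inBase = isBaseRole ∘ role
  inW    = isWRole ∘ role

  firstCornerAt : Fin n → Fin n → Bool
  firstCornerAt w = isFirstCornerAt w ∘ role

  role-satisfies : ∀ {x ρ} (P : Role → Bool) → role x ≡ ρ → T (P ρ) → T (P (role x))
  role-satisfies P eq = subst (T ∘ P) (sym eq)

  inBase-role : ∀ {y} → T (inBase y) → role y ≡ w-vertex y ⊎ role y ≡ u-vertex y
  inBase-role {y} b with role y in eq
  ... | w-vertex z with role-w-vertex eq
  ...   | _ , refl = inj₁ refl
  inBase-role {y} b | u-vertex z with role-u-vertex eq
  ...   | refl , _ = inj₂ refl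

  inW-role : ∀ {y} → T (inW y) → role y ≡ w-vertex y
  inW-role {y} w with role y in eq
  ... | w-vertex z with role-w-vertex eq
  ...   | _ , refl = refl

  pendant-anchor : ∀ {x u} → role x ≡ pendant-of u → role u ≡ u-vertex u
  pendant-anchor {x} eq with role-pendant-of eq
  ... | f , f∈ , x∈f , β , k , s , refl
    rewrite role-other {x} f∈ | k | side-other {x} f∈ | s
          | dec-false (not β ≟ᵇ β) (not-¬ refl ∘ sym) = refl

  triangle-apex : ∀ {x w h s} → role x ≡ triangle-at w h s → role w ≡ w-vertex w
  triangle-apex eq with role-triangle-at eq
  ... | _ , _ , k , _ = role-uncovered (proj₁ (kind-triangle k))

  first-corner : ∀ {x w h s} → role x ≡ triangle-at w h s → role (proj₁ h) ≡ triangle-at w h false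
  first-corner eq with role-triangle-at eq
  ... | h∈ , _ , k , _ rewrite role-covered h∈ (inj₁ refl) | k =
    cong (triangle-at _ _) (side-endpoint false h∈)

  isFirstCornerAt-self : ∀ w h → T (isFirstCornerAt w (triangle-at w h false))
  isFirstCornerAt-self w h rewrite dec-true (w ≟ w) refl = tt

  firstCorner-role : ∀ {w y} → T (firstCornerAt w y) → ∃[ h ] role y ≡ triangle-at w h false
  firstCorner-role {w} {y} c with role y
  ... | triangle-at v h s with v ≟ w | s
  ...   | yes refl | false = h , refl

  m : ℕ
  m = count inBase

  baseVertex : Fin m → Fin n
  baseVertex = enum inBase

  baseIndex : (x : Fin n) → T (inBase x) → Fin m
  baseIndex = index inBase

  baseVertex-baseIndex : ∀ x (b : T (inBase x)) → baseVertex (baseIndex x b) ≡ x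
  baseVertex-baseIndex = enum-index inBase

  Base : Graph m
  Base = record
    { Adj    = λ i j → baseVertex i ~ baseVertex j
    ; sym    = ~-sym
    ; irrefl = Graph.irrefl G
    ; dec    = λ i j → Graph.dec G (baseVertex i) (baseVertex j)
    }

  Wset : Subset m
  Wset = tabulate (inW ∘ baseVertex)

  -- The triangles at w are indexed by their first corners.
  triangles : Fin m → ℕ
  triangles i = count (firstCornerAt (baseVertex i))

  firstCorner : (i : Fin m) → Fin (triangles i) → Fin n
  firstCorner i = enum (firstCornerAt (baseVertex i))

  Target : Set
  Target = CV Base Wset triangles

  ∈Wset : ∀ {i} → T (inW (baseVertex i)) → i ∈ Wset
  ∈Wset {i} w = lookup⇒[]= i Wset (trans (lookup∘tabulate _ i) (Equivalence.to T-≡ w))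

  ∈∁Wset : ∀ {i} → T (not (inW (baseVertex i))) → i ∈ ∁ Wset
  ∈∁Wset {i} u = lookup⇒[]= i (∁ Wset)
    (trans (lookup-map i not Wset) (cong not (trans (lookup∘tabulate _ i) (Equivalence.to T-not-≡ u))))

  ∈Wset⁻ : ∀ {i} → i ∈ Wset → T (inW (baseVertex i))
  ∈Wset⁻ {i} i∈ = Equivalence.from T-≡ (trans (sym (lookup∘tabulate _ i)) ([]=⇒lookup i∈))

  ∈∁Wset⁻ : ∀ {i} → i ∈ ∁ Wset → T (not (inW (baseVertex i)))
  ∈∁Wset⁻ {i} i∈ = Equivalence.from T-≡
    (trans (cong not (sym (lookup∘tabulate _ i))) (trans (sym (lookup-map i not Wset)) ([]=⇒lookup i∈)))

  Valid : Role → Set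
  Valid (w-vertex x)        = T (inBase x)
  Valid (u-vertex x)        = T (inBase x)
  Valid (pendant-of u)      = T (inBase u) × T (not (inW u))
  Valid (triangle-at w h s) = T (inBase w) × T (inW w) × T (firstCornerAt w (proj₁ h))

  Valid-irrelevant : ∀ ρ (v v′ : Valid ρ) → v ≡ v′
  Valid-irrelevant (w-vertex x) = T-irrelevant
  Valid-irrelevant (u-vertex x) = T-irrelevant
  Valid-irrelevant (pendant-of u) (b , nw) (b′ , nw′) =
    cong₂ _,_ (T-irrelevant b b′) (T-irrelevant nw nw′)
  Valid-irrelevant (triangle-at w h s) (b , iw , c) (b′ , iw′ , c′) =
    cong₂ _,_ (T-irrelevant b b′) (cong₂ _,_ (T-irrelevant iw iw′) (T-irrelevant c c′))

  role-valid : ∀ x → Valid (role x)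
  role-valid x with role x in eq
  ... | w-vertex z with role-w-vertex eq
  ...   | _ , refl = role-satisfies isBaseRole eq tt
  role-valid x | u-vertex z with role-u-vertex eq
  ...   | refl , _ = role-satisfies isBaseRole eq tt
  role-valid x | pendant-of u =
    role-satisfies isBaseRole (pendant-anchor eq) tt ,
    role-satisfies (not ∘ isWRole) (pendant-anchor eq) tt
  role-valid x | triangle-at w h s =
    role-satisfies isBaseRole (triangle-apex eq) tt ,
    role-satisfies isWRole (triangle-apex eq) tt ,
    role-satisfies (isFirstCornerAt w) (first-corner eq) (isFirstCornerAt-self w h)

  realize : (ρ : Role) → Valid ρ → Target
  realize (w-vertex x)        b          = base (baseIndex x b)
  realize (u-vertex x)        b          = base (baseIndex x b)
  realize (pendant-of u)      (b , nw)   =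
    pend (baseIndex u b) (∈∁Wset (subst (T ∘ not ∘ inW) (sym (baseVertex-baseIndex u b)) nw))
  realize (triangle-at w h s) (b , iw , c) =
    tri (baseIndex w b) (∈Wset (subst (T ∘ inW) (sym (baseVertex-baseIndex w b)) iw))
        (index (firstCornerAt (baseVertex (baseIndex w b))) (proj₁ h)
               (subst (λ v → T (firstCornerAt v (proj₁ h))) (sym (baseVertex-baseIndex w b)) c))
        s

  -- Kept opaque: letting the lemmas below unfold role-valid makes checking them much slower.
  opaque
    toTarget : Fin n → Target
    toTarget x = realize (role x) (role-valid x)

    toTarget-realize : ∀ {x ρ} → role x ≡ ρ → (v : Valid ρ) → toTarget x ≡ realize ρ v
    toTarget-realize {x} refl v = cong (realize (role x)) (Valid-irrelevant (role x) (role-valid x) v)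

  valid-of : ∀ {x ρ} → role x ≡ ρ → Valid ρ
  valid-of {x} eq = subst Valid eq (role-valid x)

  corner : Bool → Fin n → Fin n
  corner false y = y
  corner true  y = partner y

  fromTarget : Target → Fin n
  fromTarget (base i)      = baseVertex i
  fromTarget (pend u _)    = partner (baseVertex u)
  fromTarget (tri i _ k s) = corner s (firstCorner i k)

  vertexOf : Role → Fin n
  vertexOf (w-vertex x)        = x
  vertexOf (u-vertex x)        = x
  vertexOf (pendant-of u)      = partner u
  vertexOf (triangle-at w h s) = corner s (proj₁ h)

  fromTarget-realize : ∀ ρ (v : Valid ρ) → fromTarget (realize ρ v) ≡ vertexOf ρ
  fromTarget-realize (w-vertex x)        b           = baseVertex-baseIndex x b
  fromTarget-realize (u-vertex x)        b           = baseVertex-baseIndex x b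
  fromTarget-realize (pendant-of u)      (b , _)     = cong partner (baseVertex-baseIndex u b)
  fromTarget-realize (triangle-at w h s) (b , _ , _) = cong (corner s) (enum-index _ (proj₁ h) _)

  vertexOf-role : ∀ x → vertexOf (role x) ≡ x
  vertexOf-role x with role x in eq
  ... | w-vertex z = proj₂ (role-w-vertex eq)
  ... | u-vertex z = proj₁ (role-u-vertex eq)
  ... | pendant-of u with role-pendant-of eq
  ...   | f , f∈ , x∈f , _ , _ , _ , refl =
    trans (partner-on f∈ (other-∈ₑ x f)) (other-involutive f∈ x∈f)
  vertexOf-role x | triangle-at w h false with role-triangle-at eq
  ...   | _ , x∈h , _ , side≡ = endpoint-of-side x∈h side≡
  vertexOf-role x | triangle-at w h true with role-triangle-at eq
  ...   | h∈ , x∈h , _ , side≡ =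
    trans (partner-on h∈ (inj₁ refl)) (trans (other-first {h}) (endpoint-of-side x∈h side≡))

  from-to : ∀ x → fromTarget (toTarget x) ≡ x
  from-to x = trans (cong fromTarget (toTarget-realize refl (role-valid x)))
                    (trans (fromTarget-realize (role x) (role-valid x)) (vertexOf-role x))

  u-role : ∀ {u} → u ∈ ∁ Wset → role (baseVertex u) ≡ u-vertex (baseVertex u)
  u-role {u} u∈ with inBase-role (enum-satisfies inBase u)
  ... | inj₁ r = ⊥-elim (subst (T ∘ not ∘ isWRole) r (∈∁Wset⁻ u∈))
  ... | inj₂ r = r

  corner-role : ∀ i k s → ∃[ h ] h ∈ᴸ M × firstCorner i k ≡ proj₁ h ×
                role (corner s (firstCorner i k)) ≡ triangle-at (baseVertex i) h s
  corner-role i k s with firstCorner-role (enum-satisfies (firstCornerAt (baseVertex i)) k)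
  ... | h , r with role-triangle-at r
  ...   | h∈ , y∈h , _ , side≡ = h , h∈ , y≡first , role-corner s
    where
    y = firstCorner i k
    y≡first : y ≡ proj₁ h
    y≡first = sym (endpoint-of-side y∈h side≡)
    role-corner : ∀ s → role (corner s y) ≡ triangle-at (baseVertex i) h s
    role-corner false = r
    role-corner true  = trans (cong role (partner-on h∈ y∈h)) (role-other-corner r)

  pend-cong : ∀ {u u′} → u ≡ u′ → (h : u ∈ ∁ Wset) (h′ : u′ ∈ ∁ Wset) →
              _≡_ {A = Target} (pend u h) (pend u′ h′)
  pend-cong refl h h′ = cong (pend _) ([]=-irrelevant h h′)

  tri-cong : ∀ {i j} → i ≡ j → (h : i ∈ Wset) (h′ : j ∈ Wset) {y : Fin n}
             (c : T (firstCornerAt (baseVertex i) y)) (c′ : T (firstCornerAt (baseVertex j) y)) (s : Bool) →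
             _≡_ {A = Target} (tri i h (index (firstCornerAt (baseVertex i)) y c) s)
                              (tri j h′ (index (firstCornerAt (baseVertex j)) y c′) s)
  tri-cong refl h h′ c c′ s rewrite []=-irrelevant h h′ | T-irrelevant c c′ = refl

  to-from : ∀ t → toTarget (fromTarget t) ≡ t
  to-from (base i) with inBase-role (enum-satisfies inBase i)
  ... | inj₁ r = trans (toTarget-realize r b) (cong base (index-enum inBase i b))
    where b = enum-satisfies inBase i
  ... | inj₂ r = trans (toTarget-realize r b) (cong base (index-enum inBase i b))
    where b = enum-satisfies inBase i
  to-from (pend u u∈) with role-other-u-vertex (u-role u∈)
  ... | f , f∈ , x∈f , r =
    trans (toTarget-realize partner-role (b , ∈∁Wset⁻ u∈)) (pend-cong (index-enum inBase u b) _ u∈)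
    where
    b = enum-satisfies inBase u
    partner-role : role (partner (baseVertex u)) ≡ pendant-of (baseVertex u)
    partner-role = trans (cong role (partner-on f∈ x∈f)) r
  to-from (tri i i∈ k s) = let h , _ , y≡first , r = corner-role i k s in
    to-corner i∈ k s y≡first r
    where
    to-corner : ∀ {i} (i∈ : i ∈ Wset) k s {h} → firstCorner i k ≡ proj₁ h →
                role (corner s (firstCorner i k)) ≡ triangle-at (baseVertex i) h s →
                toTarget (corner s (firstCorner i k)) ≡ tri i i∈ k s
    to-corner {i} i∈ k s y≡first r =
      trans (toTarget-realize r (b , ∈Wset⁻ i∈ , c))
            (trans (tri-cong (index-enum inBase i b) _ i∈ _ c s)
                   (cong (λ k → tri i i∈ k s)
                         (index-unique (firstCornerAt (baseVertex i)) k (sym y≡first) c)))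
      where
      b = enum-satisfies inBase i
      c = subst (T ∘ firstCornerAt (baseVertex i)) y≡first (enum-satisfies (firstCornerAt (baseVertex i)) k)

  TargetAdj : Target → Target → Set
  TargetAdj = CAdj Base Wset triangles

  apex-adj : ∀ {x w h s} → role x ≡ triangle-at w h s → w ~ x
  apex-adj eq with role-triangle-at eq
  ... | _ , inj₁ refl , k , _ = proj₁ (proj₂ (kind-triangle k))
  ... | _ , inj₂ refl , k , _ = proj₂ (proj₂ (kind-triangle k))

  partner-adj : ∀ {x f} → f ∈ᴸ M → x ∈ₑ f → x ~ partner x
  partner-adj f∈ x∈f = subst (_ ~_) (sym (partner-on f∈ x∈f)) (other-adj f∈ x∈f)

  edge-sound : ∀ {t t′} → CEdge Base Wset triangles t t′ → fromTarget t ~ fromTarget t′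
  edge-sound (bb a) = a
  edge-sound (bp u u∈) =
    let _ , f∈ , x∈f , _ = role-other-u-vertex (u-role u∈) in partner-adj f∈ x∈f
  edge-sound (bt w _ k β) =
    let _ , _ , _ , r = corner-role w k β in apex-adj r
  edge-sound (D.tt w _ k) =
    let _ , h∈ , y≡first , _ = corner-role w k false in partner-adj h∈ (inj₁ y≡first)

  target-adj⇒adj : ∀ x y → TargetAdj (toTarget x) (toTarget y) → x ~ y
  target-adj⇒adj x y (inj₁ e) = subst₂ _~_ (from-to x) (from-to y) (edge-sound e)
  target-adj⇒adj x y (inj₂ e) = ~-sym (subst₂ _~_ (from-to y) (from-to x) (edge-sound e))

  data RoleView (x : Fin n) : Set where
    is-w       : role x ≡ w-vertex x → RoleView x
    is-u       : role x ≡ u-vertex x → RoleView x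
    is-pendant : ∀ u → role x ≡ pendant-of u → RoleView x
    is-corner  : ∀ w h s → role x ≡ triangle-at w h s → RoleView x

  roleView : ∀ x → RoleView x
  roleView x with role x in eq
  ... | w-vertex z with role-w-vertex eq
  ...   | _ , refl = is-w eq
  roleView x | u-vertex z with role-u-vertex eq
  ...   | refl , _ = is-u eq
  roleView x | pendant-of u      = is-pendant u eq
  roleView x | triangle-at w h s = is-corner w h s eq

  realized-adj : ∀ {x y ρ σ} → role x ≡ ρ → (v : Valid ρ) → role y ≡ σ → (v′ : Valid σ) →
                 TargetAdj (realize ρ v) (realize σ v′) → TargetAdj (toTarget x) (toTarget y)
  realized-adj rx v ry v′ = subst₂ TargetAdj (sym (toTarget-realize rx v)) (sym (toTarget-realize ry v′))

  base-adj : ∀ {x y} (b : T (inBase x)) (b′ : T (inBase y)) → x ~ y →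
             baseVertex (baseIndex x b) ~ baseVertex (baseIndex y b′)
  base-adj b b′ = subst₂ _~_ (sym (baseVertex-baseIndex _ b)) (sym (baseVertex-baseIndex _ b′))

  adj⇒target-adj : ∀ x y → x ~ y → TargetAdj (toTarget x) (toTarget y)
  adj⇒target-adj x y x~y with roleView x
  ... | is-w rx with w-neighbour rx x~y
  ...   | inj₁ ry =
    realized-adj rx (valid-of rx) ry (valid-of ry) (inj₁ (bb (base-adj (valid-of rx) (valid-of ry) x~y)))
  ...   | inj₂ (_ , s , ry) = realized-adj rx (proj₁ (valid-of ry)) ry (valid-of ry) (inj₁ (bt _ _ _ s))
  adj⇒target-adj x y x~y | is-u rx with u-neighbour rx x~y
  ...   | inj₁ ry = realized-adj rx (proj₁ (valid-of ry)) ry (valid-of ry) (inj₁ (bp _ _))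
  ...   | inj₂ y-unc =
    realized-adj rx (valid-of rx) ry (valid-of ry) (inj₁ (bb (base-adj (valid-of rx) (valid-of ry) x~y)))
    where ry = role-uncovered y-unc
  adj⇒target-adj x y x~y | is-pendant u rx with pendant-neighbour rx x~y
  ...   | refl = realized-adj rx (valid-of rx) (pendant-anchor rx) (proj₁ (valid-of rx)) (inj₂ (bp _ _))
  adj⇒target-adj x y x~y | is-corner w h s rx with triangle-neighbour rx x~y
  ...   | inj₂ refl =
    realized-adj rx (valid-of rx) (triangle-apex rx) (proj₁ (valid-of rx)) (inj₂ (bt _ _ _ s))
  ...   | inj₁ ry with s
  ...     | false = realized-adj rx (valid-of rx) ry (valid-of rx) (inj₁ (D.tt _ _ _))
  ...     | true  = realized-adj rx (valid-of rx) ry (valid-of rx) (inj₂ (D.tt _ _ _))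

  toTarget-iso : IsoTo G Target TargetAdj
  toTarget-iso = mk↔ₛ′ toTarget fromTarget to-from from-to ,
                 λ x y → mk⇔ (adj⇒target-adj x y) (target-adj⇒adj x y)

  Base-bipartite : IsBipartition Base Wset
  Base-bipartite i j a with inBase-role (enum-satisfies inBase i) | inBase-role (enum-satisfies inBase j)
  ... | inj₁ ri | inj₁ rj =
    ⊥-elim (uncovered-independent (proj₁ (role-w-vertex ri)) (proj₁ (role-w-vertex rj)) a)
  ... | inj₁ ri | inj₂ rj =
    inj₁ (∈Wset (role-satisfies isWRole ri tt) , ∈∁Wset (role-satisfies (not ∘ isWRole) rj tt))
  ... | inj₂ ri | inj₁ rj =
    inj₂ (∈∁Wset (role-satisfies (not ∘ isWRole) ri tt) , ∈Wset (role-satisfies isWRole rj tt))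
  ... | inj₂ ri | inj₂ rj with u-neighbour ri a
  ...   | inj₁ rp with trans (sym rp) rj
  ...     | ()
  Base-bipartite i j a | inj₂ ri | inj₂ rj | inj₂ j-unc with trans (sym (role-uncovered j-unc)) rj
  ...     | ()

  triangles-nonempty : ∀ i → i ∈ Wset → 1 ≤ triangles i
  triangles-nonempty i i∈ =
    let w-unc , _ = role-w-vertex (inW-role (∈Wset⁻ i∈))
        f , f∈ , apex = uncovered-apex w-unc
        first : role (proj₁ f) ≡ triangle-at (baseVertex i) f false
        first = trans (role-covered f∈ (inj₁ refl))
                      (trans (cong (roleIn (proj₁ f) f) (apex⇒kind f∈ w-unc apex))
                             (cong (triangle-at _ _) (side-endpoint false f∈)))
    in satisfied⇒1≤count (firstCornerAt (baseVertex i)) (proj₁ f)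
         (role-satisfies (isFirstCornerAt (baseVertex i)) first (isFirstCornerAt-self (baseVertex i) f))

  anchor : Role → Fin n
  anchor (w-vertex x)        = x
  anchor (u-vertex x)        = x
  anchor (pendant-of u)      = u
  anchor (triangle-at w _ _) = w

  anchor-inBase : ∀ x → T (inBase (anchor (role x)))
  anchor-inBase x with roleView x
  ... | is-w rx            = subst (T ∘ inBase ∘ anchor) (sym rx) (role-satisfies isBaseRole rx tt)
  ... | is-u rx            = subst (T ∘ inBase ∘ anchor) (sym rx) (role-satisfies isBaseRole rx tt)
  ... | is-pendant u rx    = subst (T ∘ inBase ∘ anchor) (sym rx)
                                   (role-satisfies isBaseRole (pendant-anchor rx) tt)
  ... | is-corner w h s rx = subst (T ∘ inBase ∘ anchor) (sym rx)
                                   (role-satisfies isBaseRole (triangle-apex rx) tt)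

  anchorIndex : Fin n → Fin m
  anchorIndex x = baseIndex (anchor (role x)) (anchor-inBase x)

  anchor-step : ∀ {x y} → x ~ y → anchor (role x) ≡ anchor (role y) ⊎ anchor (role x) ~ anchor (role y)
  anchor-step {x} {y} x~y with roleView x
  ... | is-w rx with w-neighbour rx x~y
  ...   | inj₁ ry           = inj₂ (subst₂ _~_ (sym (cong anchor rx)) (sym (cong anchor ry)) x~y)
  ...   | inj₂ (_ , _ , ry) = inj₁ (trans (cong anchor rx) (sym (cong anchor ry)))
  anchor-step {x} {y} x~y | is-u rx with u-neighbour rx x~y
  ...   | inj₁ ry    = inj₁ (trans (cong anchor rx) (sym (cong anchor ry)))
  ...   | inj₂ y-unc =
    inj₂ (subst₂ _~_ (sym (cong anchor rx)) (sym (cong anchor (role-uncovered y-unc))) x~y)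
  anchor-step {x} {y} x~y | is-pendant u rx with pendant-neighbour rx x~y
  ...   | refl = inj₁ (trans (cong anchor rx) (sym (cong anchor (pendant-anchor rx))))
  anchor-step {x} {y} x~y | is-corner w h s rx with triangle-neighbour rx x~y
  ...   | inj₁ ry   = inj₁ (trans (cong anchor rx) (sym (cong anchor ry)))
  ...   | inj₂ refl = inj₁ (trans (cong anchor rx) (sym (cong anchor (triangle-apex rx))))

  reachable-anchors : ∀ {x z} → Reachable G x z → Reachable Base (anchorIndex x) (anchorIndex z)
  reachable-anchors D.here = D.here
  reachable-anchors {x} {z} (D.step {y = y} x~y y⇝z) with anchor-step x~y
  ... | inj₁ same = subst (λ i → Reachable Base i (anchorIndex z))
                          (sym (index-cong inBase same (anchor-inBase x) (anchor-inBase y)))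
                          (reachable-anchors y⇝z)
  ... | inj₂ a~b  = D.step (base-adj (anchor-inBase x) (anchor-inBase y) a~b) (reachable-anchors y⇝z)

  anchorIndex-baseVertex : ∀ i → anchorIndex (baseVertex i) ≡ i
  anchorIndex-baseVertex i = index-unique inBase i anchor≡ (anchor-inBase (baseVertex i))
    where
    anchor≡ : anchor (role (baseVertex i)) ≡ baseVertex i
    anchor≡ with inBase-role (enum-satisfies inBase i)
    ... | inj₁ r = cong anchor r
    ... | inj₂ r = cong anchor r

  Base-connected : Connected G → Connected Base
  Base-connected (x , reach) =
    anchorIndex x , λ i j → subst₂ (Reachable Base) (anchorIndex-baseVertex i) (anchorIndex-baseVertex j)
                                   (reachable-anchors (reach (baseVertex i) (baseVertex j)))

  roleOnEdge-not-w : ∀ x f → isWRole (roleOnEdge x f) ≡ false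
  roleOnEdge-not-w x f with kind f
  ... | triangle w = refl
  ... | pendant β with side x f ≟ᵇ β
  ...   | yes _ = refl
  ...   | no  _ = refl

  not-inW≡covered : ∀ x → not (inW x) ≡ does (covered? x)
  not-inW≡covered x with role-cases x
  ... | inj₁ (x-unc , r) = trans (cong (not ∘ isWRole) r) (sym (dec-false (covered? x) x-unc))
  ... | inj₂ (f , f∈ , x∈f , r) =
    trans (cong (not ∘ isWRole) r)
          (trans (cong not (roleOnEdge-not-w x f)) (sym (dec-true (covered? x) (f , f∈ , x∈f))))

  inBase∧inW : ∀ x → (inBase x ∧ inW x) ≡ inW x
  inBase∧inW x with role x
  ... | w-vertex _        = refl
  ... | u-vertex _        = refl
  ... | pendant-of _      = refl
  ... | triangle-at _ _ _ = refl

  ∣Wset∣≡count : ∣ Wset ∣ ≡ count inW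
  ∣Wset∣≡count = trans (∣tabulate∣≡count (inW ∘ baseVertex))
                       (trans (count-∘enum inBase inW) (count-cong _ _ inBase∧inW))

  -- Every vertex outside W lies on exactly one edge of M.
  n≡∣W∣+2k : n ≡ count inW + 2 * k
  n≡∣W∣+2k = begin
    n
      ≡⟨ sym (count-complement inW) ⟩
    count inW + count (not ∘ inW)
      ≡⟨ cong (count inW +_) (count-cong _ _ not-inW≡covered) ⟩
    count inW + count (λ x → does (covered? x))
      ≡⟨ cong (count inW +_) (count-covered G M (induced⇒matching G M-induced)) ⟩
    count inW + 2 * length M
      ≡⟨ cong (λ l → count inW + 2 * l) |M|≡k ⟩
    count inW + 2 * k ∎
    where open ≡-Reasoning

  2k≡n∸∣W∣ : 2 * k ≡ n ∸ ∣ Wset ∣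
  2k≡n∸∣W∣ =
    trans (sym (m+n∸m≡n (count inW) (2 * k))) (cong₂ _∸_ (sym n≡∣W∣+2k) (sym ∣Wset∣≡count))

≤-≤-+≡2*⇒≡ : ∀ {a b c} → a ≤ b → a ≤ c → b + c ≡ 2 * a → b ≡ a × c ≡ a
≤-≤-+≡2*⇒≡ {a} {b} {c} a≤b a≤c sum = ≤-antisym b≤a a≤b , ≤-antisym c≤a a≤c
  where
  sum′ : b + c ≡ a + a
  sum′ = trans sum (cong (a +_) (+-identityʳ a))
  b≤a : b ≤ a
  b≤a = +-cancelʳ-≤ a b a (≤-trans (+-monoʳ-≤ b a≤c) (≤-reflexive sum′))
  c≤a : c ≤ a
  c≤a = +-cancelʳ-≤ a c a
          (≤-trans (≤-reflexive (+-comm c a)) (≤-trans (+-monoˡ-≤ c a≤b) (≤-reflexive sum′)))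

lemma21 : (n : ℕ) (G : Graph n) → Connected G →
    (mm is im : ℕ) → MM≡ G mm → IS≡ G is → IM≡ G im →
    mm + is ≡ 2 * im →
    IsoTo G Bool K2Adj
    ⊎ (Σ ℕ λ t → IsoTo G (TSV t) (TSAdj t))
    ⊎ (Σ ℕ λ m → Σ (Graph m) λ G' → Σ (Subset m) λ W → Σ (Fin m → ℕ) λ t →
        Connected G' × IsBipartition G' W × (∀ w → w ∈ W → 1 ≤ t w)
        × IsoTo G (CV G' W t) (CAdj G' W t)
        × mm ≡ is × is ≡ im × 2 * im ≡ n ∸ ∣ W ∣)
lemma21 n G connected mm is im (_ , mm-bound) (_ , is-bound) ((M , M-induced , |M|≡im) , _) sum =
  inj₂ (inj₂ (m , Base , Wset , triangles , Base-connected connected , Base-bipartite ,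
              triangles-nonempty , toTarget-iso , trans mm≡im (sym is≡im) , is≡im , 2k≡n∸∣W∣))
  where
  im≤mm : im ≤ mm
  im≤mm = subst (_≤ mm) |M|≡im (mm-bound M (induced⇒matching G M-induced))
  im≤is : im ≤ is
  im≤is = subst (_≤ is) (trans (length-map proj₁ M) |M|≡im)
                (is-bound (map proj₁ M) (induced⇒firsts-independent G M-induced))
  mm≡im : mm ≡ im
  mm≡im = proj₁ (≤-≤-+≡2*⇒≡ im≤mm im≤is sum)
  is≡im : is ≡ im
  is≡im = proj₂ (≤-≤-+≡2*⇒≡ im≤mm im≤is sum)
  open Structure G M im M-induced |M|≡im
    (λ N N-matching → subst (length N ≤_) mm≡im (mm-bound N N-matching))
    (λ S S-independent → subst (length S ≤_) is≡im (is-bound S S-independent))
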